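{- Let $G=(V,E)$ be a graph and $\sigma$ an arbitrary ordering of $V=\{v_1,\dots,v_n\}$ with $v_1<_\sigma\dots<_\sigma v_n$. Let $M$ and $M'$ be two different matchings of $G$ such that $v_i$ is the rightmost difference between $M$ and $M'$, that is, each vertex $v_\ell$ with $\ell>i$ is either free in both $M$ and $M'$ or matched to the same vertex $v_{\ell'}$ in both $M$ and $M'$. Suppose that $\{v_j,v_i\}\in M'\setminus M$ with $j<i$, and that $v_i$ is in $M$ either free or matched to some $v_{j'}$ with $j'<j$. Then $f(M')<f(M)$.
   Context: A matching is a set of pairwise disjoint edges; a vertex is free with respect to a matching if no edge of it contains the vertex. For a matching $M$ and the ordering $v_1,\dots,v_n$, define $f(M)=\sum_{i=1}^n g_M(v_i)$, where $g_M(v_i)=0$ if $\{v_i,v_j\}\in M$ with $i<j$; $g_M(v_i)=(i-j)(n+1)^i$ if $\{v_i,v_j\}\in M$ with $j<i$; and $g_M(v_i)=i(n+1)^i$ if $v_i$ is free with respect to $M$. -}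

module Defs where

open import Data.Nat using (ℕ; zero; suc; _+_; _*_; _∸_; _^_; _<_; _<?_)
open import Data.Fin using (Fin; toℕ)
import Data.Fin as F
open import Data.Maybe using (Maybe; just; nothing)
open import Data.Product using (_×_)
open import Relation.Binary.PropositionalEquality using (_≡_; _≢_)
open import Relation.Nullary using (¬_; yes; no)

-- Vertex v_i is represented by  i : Fin n  with  toℕ i = i - 1,
-- so the ordering σ is v_1 <σ … <σ v_n, i.e. the natural order of Fin n.
record Graph (n : ℕ) : Set₁ where
  field
    Adj       : Fin n → Fin n → Set
    Adj-sym   : ∀ {u v} → Adj u v → Adj v u
    Adj-irr   : ∀ {u} → ¬ Adj u u
open Graph public

idx : ∀ {n} → Fin n → ℕ
idx i = suc (toℕ i)

-- A matching, encoded by its partner map: M v ≡ just u  iff  {v,u} ∈ M,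
-- M v ≡ nothing iff v is free.  Disjointness of the edges is built in
-- (each vertex has at most one partner).
Matching : ℕ → Set
Matching n = Fin n → Maybe (Fin n)

record IsMatching {n : ℕ} (G : Graph n) (M : Matching n) : Set where
  field
    sym   : ∀ {u v} → M u ≡ just v → M v ≡ just u
    edge  : ∀ {u v} → M u ≡ just v → Adj G u v

sumFin : (n : ℕ) → (Fin n → ℕ) → ℕ
sumFin zero    h = 0
sumFin (suc n) h = h F.zero + sumFin n (λ i → h (F.suc i))

g : (n : ℕ) → Matching n → Fin n → ℕ
g n M i with M i
... | nothing = idx i * (suc n ^ idx i)
... | just j with idx j <? idx i
...   | yes _ = (idx i ∸ idx j) * (suc n ^ idx i)
...   | no  _ = 0

f : (n : ℕ) → Matching n → ℕ
f n M = sumFin n (g n M)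

-- Read f(M) in base n + 1: vertex v_ℓ contributes less than n + 1 units at
-- digit ℓ, so the lower vertices together contribute less than one unit at
-- digit i.  Above i the two matchings agree, and at v_i the contribution of
-- M exceeds that of M' by at least (j - j') units at digit i (with j' = 0 when
-- v_i is free in M), which outweighs everything below.
module Submission where

open import Defs
open import Data.Nat using (ℕ; _<_)
open import Data.Fin using (Fin; toℕ)
open import Data.Maybe using (Maybe; just; nothing)
open import Data.Product using (_×_; ∃-syntax)
open import Data.Sum using (_⊎_)
open import Relation.Binary.PropositionalEquality using (_≡_; _≢_)

open import Data.Nat using (zero; suc; _+_; _*_; _∸_; _^_; _≤_; z≤n; s≤s; _<?_)
open import Data.Nat.Properties
  using (≤-refl; ≤-trans; +-assoc; +-monoˡ-≤; +-monoʳ-≤; m≤n+m; *-monoˡ-≤; m∸n≤m; ∸-monoʳ-<; <⇒≤; <-trans)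
import Data.Fin as F
open import Data.Fin.Properties using (toℕ<n)
open import Data.Vec.Functional using (tail)
open import Data.Product using (_,_)
open import Data.Sum using (inj₁; inj₂)
open import Relation.Binary.PropositionalEquality using (refl; sym; cong; cong₂)
open import Relation.Nullary using (yes; no; contradiction)

sumFin-cong : ∀ m {a b : Fin m → ℕ} → (∀ ℓ → a ℓ ≡ b ℓ) → sumFin m a ≡ sumFin m b
sumFin-cong zero    a≡b = refl
sumFin-cong (suc m) a≡b = cong₂ _+_ (a≡b F.zero) (sumFin-cong m (λ ℓ → a≡b (F.suc ℓ)))

sumFin-dominates : ∀ m c (w : ℕ → ℕ) → (∀ k → suc c * w k ≤ w (suc k)) →
  (a b : Fin m → ℕ) (i : Fin m) →
  (∀ ℓ → toℕ ℓ < toℕ i → a ℓ ≤ c * w (toℕ ℓ)) →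
  w (toℕ i) + a i ≤ b i →
  (∀ ℓ → toℕ i < toℕ ℓ → a ℓ ≡ b ℓ) →
  w 0 + sumFin m a ≤ sumFin m b
sumFin-dominates (suc m) c w increasing a b F.zero below gap above =
  begin
    w 0 + (a F.zero + sumFin m (tail a))  ≡⟨ sym (+-assoc (w 0) (a F.zero) _) ⟩
    w 0 + a F.zero + sumFin m (tail a)    ≤⟨ +-monoˡ-≤ _ gap ⟩
    b F.zero + sumFin m (tail a)          ≡⟨ cong (b F.zero +_) (sumFin-cong m (λ ℓ → above (F.suc ℓ) (s≤s z≤n))) ⟩
    b F.zero + sumFin m (tail b)          ∎
  where
  open Data.Nat.Properties.≤-Reasoning
sumFin-dominates (suc m) c w increasing a b (F.suc i) below gap above =
  begin
    w 0 + (a F.zero + sumFin m (tail a))      ≤⟨ +-monoʳ-≤ (w 0) (+-monoˡ-≤ _ (below F.zero (s≤s z≤n))) ⟩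
    w 0 + (c * w 0 + sumFin m (tail a))       ≡⟨ sym (+-assoc (w 0) (c * w 0) _) ⟩
    suc c * w 0 + sumFin m (tail a)           ≤⟨ +-monoˡ-≤ _ (increasing 0) ⟩
    w 1 + sumFin m (tail a)                   ≤⟨ rest ⟩
    sumFin m (tail b)                         ≤⟨ m≤n+m _ (b F.zero) ⟩
    b F.zero + sumFin m (tail b)              ∎
  where
  open Data.Nat.Properties.≤-Reasoning
  rest : w 1 + sumFin m (tail a) ≤ sumFin m (tail b)
  rest = sumFin-dominates m c (λ k → w (suc k)) (λ k → increasing (suc k))
           (tail a) (tail b) i
           (λ ℓ ℓ<i → below (F.suc ℓ) (s≤s ℓ<i)) gap (λ ℓ i<ℓ → above (F.suc ℓ) (s≤s i<ℓ))

g-cong : ∀ n {M M' : Matching n} ℓ → M ℓ ≡ M' ℓ → g n M ℓ ≡ g n M' ℓ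
g-cong n {M} {M'} ℓ M≡M' with M ℓ | M' ℓ
... | _ | _ with refl ← M≡M' = refl

g-free : ∀ n M (ℓ : Fin n) → M ℓ ≡ nothing → g n M ℓ ≡ idx ℓ * suc n ^ idx ℓ
g-free n M ℓ free rewrite free = refl

g-matched-left : ∀ n M (ℓ j : Fin n) → M ℓ ≡ just j → idx j < idx ℓ →
  g n M ℓ ≡ (idx ℓ ∸ idx j) * suc n ^ idx ℓ
g-matched-left n M ℓ j matched j<ℓ rewrite matched with idx j <? idx ℓ
... | yes _   = refl
... | no j≮ℓ  = contradiction j<ℓ j≮ℓ

g-≤ : ∀ n M (ℓ : Fin n) → g n M ℓ ≤ n * suc n ^ idx ℓ
g-≤ n M ℓ with M ℓ
... | nothing = *-monoˡ-≤ (suc n ^ idx ℓ) (toℕ<n ℓ)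
... | just j with idx j <? idx ℓ
...   | yes _ = *-monoˡ-≤ (suc n ^ idx ℓ) (≤-trans (m∸n≤m (idx ℓ) (idx j)) (toℕ<n ℓ))
...   | no  _ = z≤n

mainTheorem3 : (n : ℕ) (G : Graph n) (M M' : Matching n) →
    IsMatching G M → IsMatching G M' →
    M ≢ M' →
    (i : Fin n) →
    (∀ (ℓ : Fin n) → toℕ i < toℕ ℓ → M ℓ ≡ M' ℓ) →
    (j : Fin n) → toℕ j < toℕ i →
    M' i ≡ just j → M i ≢ just j →
    (M i ≡ nothing ⊎ (∃[ j' ] (toℕ j' < toℕ j × M i ≡ just j'))) →
    f n M' < f n M
mainTheorem3 n G M M' _ _ _ i agree j j<i M'ij _ M-at-i =
  -- The weights (n+1)^(k+1) satisfy the growth condition definitionally.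
  ≤-trans (+-monoˡ-≤ (f n M') (s≤s z≤n))
    (sumFin-dominates n n (λ k → suc n ^ suc k) (λ _ → ≤-refl) (g n M') (g n M) i
      (λ ℓ _ → g-≤ n M' ℓ) (gap M-at-i) (λ ℓ i<ℓ → g-cong n {M'} {M} ℓ (sym (agree ℓ i<ℓ))))
  where
  P : ℕ
  P = suc n ^ idx i
  j≤i : idx j ≤ idx i
  j≤i = <⇒≤ (s≤s j<i)
  g-M'-i : g n M' i ≡ (idx i ∸ idx j) * P
  g-M'-i = g-matched-left n M' i j M'ij (s≤s j<i)
  gap : M i ≡ nothing ⊎ (∃[ j' ] (toℕ j' < toℕ j × M i ≡ just j')) → P + g n M' i ≤ g n M i
  gap (inj₁ free) rewrite g-M'-i | g-free n M i free =
    *-monoˡ-≤ P (∸-monoʳ-< {o = 0} (s≤s z≤n) j≤i)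
  gap (inj₂ (j' , j'<j , Mij')) rewrite g-M'-i | g-matched-left n M i j' Mij' (s≤s (<-trans j'<j j<i)) =
    *-monoˡ-≤ P (∸-monoʳ-< (s≤s j'<j) j≤i)
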